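{- Let $1/n\ll\mu\ll1$. Let $H$ be an $n$-vertex graph with $\delta(H)\ge(1-\mu)n$, and let $T$ be an $n$-vertex tree containing a collection of $10\mu n$ vertex-disjoint bare paths of length $4$. Then for any vertex $t\in V(T)$ not on any of these bare paths and any $s\in V(H)$, there is a copy of $T$ in $H$ in which $t$ is copied to $s$.
   Context: Hierarchy notation: $\mu$ sufficiently small, $n$ sufficiently large in terms of $\mu$. A path $P$ in a tree $T$ is a bare path if all its internal vertices have degree $2$ in $T$; its length is its number of edges.
   Formalization: The parameter μ ranges over the positive rationals. -}

module Defs where

open import Data.Nat using (ℕ; zero; suc; _+_; _*_; _∸_; _≤_; _<_)
open import Data.Fin using (Fin; toℕ; fromℕ) renaming (zero to fzero; suc to fsuc)
open import Data.Bool using (Bool; true; false; if_then_else_)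
open import Data.List using (List; map; allFin)
open import Data.Nat.ListAction using (sum)
open import Data.Product using (Σ; ∃; ∃-syntax; _×_; _,_)
open import Relation.Binary.PropositionalEquality using (_≡_; _≢_)
open import Function.Definitions using (Injective)

record Graph (n : ℕ) : Set where
  field
    adj    : Fin n → Fin n → Bool
    sym    : ∀ i j → adj i j ≡ adj j i
    irrefl : ∀ i → adj i i ≡ false
open Graph public

E : ∀ {n} → Graph n → Fin n → Fin n → Set
E G i j = adj G i j ≡ true

degree : ∀ {n} → Graph n → Fin n → ℕ
degree {n} G i = sum (map (λ j → if adj G i j then 1 else 0) (allFin n))

Consecutive : ∀ {n m} → Graph n → (Fin m → Fin n) → Set
Consecutive G f = ∀ i j → suc (toℕ i) ≡ toℕ j → E G (f i) (f j)

Connected : ∀ {n} → Graph n → Set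
Connected {n} G = ∀ u v → ∃[ k ] Σ (Fin (suc k) → Fin n) λ f →
  f fzero ≡ u × f (fromℕ k) ≡ v × Consecutive G f

Cycle : ∀ {n} → Graph n → Set
Cycle {n} G = ∃[ k ] Σ (Fin (suc (suc (suc k))) → Fin n) λ f →
  Injective _≡_ _≡_ f × Consecutive G f × E G (f (fromℕ (suc (suc k)))) (f fzero)

IsTree : ∀ {n} → Graph n → Set
IsTree G = Connected G × (Cycle G → Data.Empty.⊥)
  where import Data.Empty

BarePath4 : ∀ {n} → Graph n → (Fin 5 → Fin n) → Set
BarePath4 T f = Injective _≡_ _≡_ f × Consecutive T f ×
  (∀ (i : Fin 5) → 1 ≤ toℕ i → toℕ i ≤ 3 → degree T (f i) ≡ 2)

DisjointBarePaths4 : ∀ {n k} → Graph n → (Fin k → Fin 5 → Fin n) → Set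
DisjointBarePaths4 T P =
  (∀ a → BarePath4 T (P a)) × (∀ a b i j → P a i ≡ P b j → a ≡ b)

Embedding : ∀ {n m} → Graph n → Graph m → (Fin n → Fin m) → Set
Embedding T H φ = Injective _≡_ _≡_ φ × (∀ u v → E T u v → E H (φ u) (φ v))

{-# OPTIONS --safe #-}
module Submission where

-- Let Δ = ⌊μn⌋: every vertex of H has at most Δ non-neighbours, and 4Δ < k.
-- Delete the midpoints of the k bare paths. The rest of T is embedded greedily from t ↦ s,
-- adding the vertices of T in an order in which each vertex has exactly one earlier
-- neighbour (T is a tree); the image of that neighbour has at least n − Δ ≥ n − k
-- neighbours in H, more than the fewer than n − k vertices used so far. In this bipartite graph between paths and
-- unused vertices every vertex misses at most 2Δ partners, so the greedy matching never
-- gets stuck: a path without a free candidate takes over the vertex of a matched path,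
-- which moves on to an unused vertex, and if even that fails, counting non-adjacent pairs
-- gives k ≤ 4Δ.

open import Defs hiding (sym)
open import Data.Nat using (ℕ; zero; suc; _+_; _*_; _∸_; _≤_; _<_; z≤n; s≤s; z<s; _/_)
open import Data.Nat.DivMod using (m*n/n≡m; /-monoˡ-≤; m/n*n≤m)
open import Data.Nat.ListAction using (sum)
open import Data.Nat.Properties
open import Data.Fin using (Fin; toℕ; fromℕ; inject≤) renaming (zero to fzero; suc to fsuc)
open import Data.Fin.Properties using (any?; toℕ<n) renaming (_≟_ to _≟ᶠ_)
open import Data.Bool using (true; false; if_then_else_)
open import Data.Bool.Properties using () renaming (_≟_ to _≟ᵇ_)
open import Data.List using (List; []; _∷_; _++_; length; map; filter; allFin; lookup)
open import Data.List.Properties using (length-++; length-map; length-tabulate)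
open import Data.List.Membership.Propositional using (_∈_; _∉_; find; lose)
open import Data.List.Membership.Propositional.Properties
  using (∈-∃++; ∈-++⁺ˡ; ∈-++⁺ʳ; ∈-++⁻; ∈-filter⁺; ∈-filter⁻; ∈-allFin; ∈-map⁺; ∈-map⁻)
open import Data.List.Relation.Binary.Subset.Propositional using (_⊆_)
open import Data.List.Relation.Unary.Any using (Any; here; there)
import Data.List.Relation.Unary.Any as Any
import Data.List.Relation.Unary.All as All
import Data.List.Relation.Unary.All.Properties as All
open import Data.List.Relation.Unary.Unique.Propositional using (Unique; []; _∷_)
open import Data.List.Relation.Unary.Unique.Propositional.Properties
  using (filter⁺; ++⁺; allFin⁺; map⁺)
open import Data.Vec.Functional using (updateAt)
open import Data.Vec.Functional.Properties using (updateAt-updates; updateAt-minimal)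
open import Data.Product using (Σ; ∃; ∃₂; ∃-syntax; _×_; _,_; proj₁; proj₂)
open import Data.Sum using (_⊎_; inj₁; inj₂)
open import Data.Unit using (⊤; tt)
open import Data.Empty using (⊥; ⊥-elim)
open import Function using (_∘_; const; id; case_of_)
open import Function.Definitions using (Injective)
open import Relation.Nullary using (¬_; Dec; yes; no; ¬?; _×-dec_; contradiction)
open import Relation.Nullary.Decidable using (decidable-stable)
open import Relation.Unary using (Decidable)
open import Relation.Unary.Properties using (∁?)
open import Relation.Binary using (DecidableEquality)
open import Relation.Binary.PropositionalEquality
  using (_≡_; _≢_; refl; sym; trans; cong; subst; subst₂; module ≡-Reasoning)

module _ {A : Set} where

  length-filter-∁ : ∀ {P : A → Set} (P? : Decidable P) xs →
                    length (filter P? xs) + length (filter (∁? P?) xs) ≡ length xs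
  length-filter-∁ P? [] = refl
  length-filter-∁ P? (x ∷ xs) with P? x
  ... | yes _ = cong suc (length-filter-∁ P? xs)
  ... | no  _ = trans (+-suc _ _) (cong suc (length-filter-∁ P? xs))

  length≤filter+filter : ∀ {P Q : A → Set} (P? : Decidable P) (Q? : Decidable Q) xs →
                         (∀ {x} → x ∈ xs → P x ⊎ Q x) →
                         length xs ≤ length (filter P? xs) + length (filter Q? xs)
  length≤filter+filter P? Q? [] _ = z≤n
  length≤filter+filter P? Q? (x ∷ xs) cover
    with P? x | Q? x | length≤filter+filter P? Q? xs (cover ∘ there)
  ... | yes _ | yes _ | ih = s≤s (≤-trans ih (+-monoʳ-≤ _ (n≤1+n _)))
  ... | yes _ | no  _ | ih = s≤s ih
  ... | no  _ | yes _ | ih = ≤-trans (s≤s ih) (≤-reflexive (sym (+-suc _ _)))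
  ... | no ¬p | no ¬q | _  with cover (here refl)
  ...   | inj₁ p = contradiction p ¬p
  ...   | inj₂ q = contradiction q ¬q

  unique-⊆⇒length≤ : ∀ {xs ys : List A} → Unique xs → xs ⊆ ys → length xs ≤ length ys
  unique-⊆⇒length≤ {[]} _ _ = z≤n
  unique-⊆⇒length≤ {x ∷ xs} (x≢xs ∷ uxs) xs⊆ys with ∈-∃++ (xs⊆ys (here refl))
  ... | pre , post , refl = begin
    suc (length xs)                ≤⟨ s≤s (unique-⊆⇒length≤ uxs xs⊆pre++post) ⟩
    suc (length (pre ++ post))     ≡⟨ cong suc (length-++ pre) ⟩
    suc (length pre + length post) ≡⟨ +-suc (length pre) _ ⟨
    length pre + suc (length post) ≡⟨ length-++ pre ⟨
    length (pre ++ x ∷ post)       ∎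
    where
    open ≤-Reasoning
    xs⊆pre++post : xs ⊆ pre ++ post
    xs⊆pre++post {y} y∈xs with ∈-++⁻ pre (xs⊆ys (there y∈xs))
    ... | inj₁ y∈pre          = ∈-++⁺ˡ y∈pre
    ... | inj₂ (here y≡x)     = contradiction (sym y≡x) (All.lookup x≢xs y∈xs)
    ... | inj₂ (there y∈post) = ∈-++⁺ʳ pre y∈post

  nonempty⇒∃∈ : ∀ {xs : List A} → 0 < length xs → ∃ (_∈ xs)
  nonempty⇒∃∈ {x ∷ _} _ = x , here refl

  ∈∧∉⇒≢ : ∀ {x y} {xs : List A} → x ∈ xs → y ∉ xs → x ≢ y
  ∈∧∉⇒≢ x∈xs y∉xs refl = y∉xs x∈xs

  ∉⇒unique-∷ : ∀ {x} {xs : List A} → x ∉ xs → Unique xs → Unique (x ∷ xs)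
  ∉⇒unique-∷ x∉xs uxs = All.¬Any⇒All¬ _ x∉xs ∷ uxs

module _ {A : Set} (_≟_ : DecidableEquality A) where

  open import Data.List.Membership.DecPropositional _≟_ using (_∈?_)

  unique-longer⇒∃∉ : ∀ {xs ys : List A} → Unique xs → length ys < length xs →
                     ∃ λ x → x ∈ xs × x ∉ ys
  unique-longer⇒∃∉ {xs} {ys} uxs ys<xs with Any.any? (λ x → ¬? (x ∈? ys)) xs
  ... | yes some = find some
  ... | no none  = contradiction (unique-⊆⇒length≤ uxs xs⊆ys) (<⇒≱ ys<xs)
    where
    xs⊆ys : xs ⊆ ys
    xs⊆ys {x} x∈xs = decidable-stable (x ∈? ys) (none ∘ lose x∈xs)

InjectiveOn : {A B : Set} → List A → (A → B) → Set
InjectiveOn D f = ∀ {a b} → a ∈ D → b ∈ D → f a ≡ f b → a ≡ b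

module _ {A B : Set} {f : A → B} where

  map⁺-injectiveOn : ∀ {xs} → Unique xs → InjectiveOn xs f → Unique (map f xs)
  map⁺-injectiveOn [] _ = []
  map⁺-injectiveOn (x≢xs ∷ uxs) inj =
    All.map⁺ (All.tabulate λ y∈xs fx≡fy → All.lookup x≢xs y∈xs (inj (here refl) (there y∈xs) fx≡fy))
    ∷ map⁺-injectiveOn uxs (λ a∈ b∈ → inj (there a∈) (there b∈))

∈-∷-≢ : ∀ {A : Set} {a i : A} {D} → a ∈ i ∷ D → a ≢ i → a ∈ D
∈-∷-≢ (here a≡i) a≢i = contradiction a≡i a≢i
∈-∷-≢ (there a∈D) _  = a∈D

module _ {m} {B : Set} (f : Fin m → B) (i : Fin m) (y : B) {D : List (Fin m)} where

  updateAt-respects : ∀ (R : Fin m → B → Set) → R i y → (∀ {a} → a ∈ D → R a (f a)) →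
                      ∀ {a} → a ∈ i ∷ D → R a (updateAt f i (const y) a)
  updateAt-respects R Riy Rf {a} a∈ with a ≟ᶠ i
  ... | yes refl = subst (R i) (sym (updateAt-updates i f)) Riy
  ... | no  a≢i  = subst (R a) (sym (updateAt-minimal a i f a≢i)) (Rf (∈-∷-≢ a∈ a≢i))

  updateAt-injectiveOn : InjectiveOn D f → (∀ {a} → a ∈ D → f a ≢ y) →
                         InjectiveOn (i ∷ D) (updateAt f i (const y))
  updateAt-injectiveOn inj fresh {a} {b} a∈ b∈ eq with a ≟ᶠ i | b ≟ᶠ i
  ... | yes refl | yes refl = refl
  ... | yes refl | no  b≢i  =
    contradiction (subst₂ _≡_ (updateAt-minimal b i f b≢i) (updateAt-updates i f) (sym eq)) (fresh (∈-∷-≢ b∈ b≢i))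
  ... | no  a≢i  | yes refl =
    contradiction (subst₂ _≡_ (updateAt-minimal a i f a≢i) (updateAt-updates i f) eq) (fresh (∈-∷-≢ a∈ a≢i))
  ... | no  a≢i  | no  b≢i  =
    inj (∈-∷-≢ a∈ a≢i) (∈-∷-≢ b∈ b≢i) (subst₂ _≡_ (updateAt-minimal a i f a≢i) (updateAt-minimal b i f b≢i) eq)

module _ {n} (G : Graph n) where

  E? : ∀ x y → Dec (E G x y)
  E? x y = adj G x y ≟ᵇ true

  E-sym : ∀ {x y} → E G x y → E G y x
  E-sym {x} {y} = trans (Graph.sym G y x)

  E-irrefl : ∀ {x} → ¬ E G x x
  E-irrefl {x} e with () ← trans (sym e) (irrefl G x)

  neighbours : Fin n → List (Fin n)
  neighbours x = filter (E? x) (allFin n)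

  coDegree : Fin n → ℕ
  coDegree x = length (filter (∁? (E? x)) (allFin n))

  degree≡length-neighbours : ∀ x → degree G x ≡ length (neighbours x)
  degree≡length-neighbours x = count (allFin n)
    where
    count : ∀ ys → sum (map (λ y → if adj G x y then 1 else 0) ys) ≡ length (filter (E? x) ys)
    count [] = refl
    count (y ∷ ys) with adj G x y
    ... | true  = cong suc (count ys)
    ... | false = count ys

  degree+coDegree≡n : ∀ x → degree G x + coDegree x ≡ n
  degree+coDegree≡n x = begin
    degree G x + coDegree x            ≡⟨ cong (_+ coDegree x) (degree≡length-neighbours x) ⟩
    length (neighbours x) + coDegree x ≡⟨ length-filter-∁ (E? x) (allFin n) ⟩
    length (allFin n)                  ≡⟨ length-tabulate id ⟩
    n                                  ∎
    where open ≡-Reasoning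

  unique-nonNeighbours≤coDegree : ∀ {x zs} → Unique zs → (∀ {z} → z ∈ zs → ¬ E G x z) →
                                  length zs ≤ coDegree x
  unique-nonNeighbours≤coDegree uzs non =
    unique-⊆⇒length≤ uzs (λ z∈zs → ∈-filter⁺ (∁? (E? _)) (∈-allFin _) (non z∈zs))

  injective-nonNeighbours≤coDegree : ∀ {A : Set} {zs : List A} {x} (f : A → Fin n) → Unique zs →
                                     InjectiveOn zs f →
                                     length (filter (λ z → ¬? (E? x (f z))) zs) ≤ coDegree x
  injective-nonNeighbours≤coDegree {A} {zs} {x} f uzs injective = begin
    length non         ≡⟨ length-map f non ⟨
    length (map f non) ≤⟨ unique-nonNeighbours≤coDegree image-unique image-non-adjacent ⟩
    coDegree x         ∎
    where
    open ≤-Reasoning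
    non : List A
    non = filter (λ z → ¬? (E? x (f z))) zs
    in-zs : ∀ {z} → z ∈ non → z ∈ zs
    in-zs = proj₁ ∘ ∈-filter⁻ _ {xs = zs}
    image-unique : Unique (map f non)
    image-unique = map⁺-injectiveOn (filter⁺ _ uzs) (λ a∈ b∈ → injective (in-zs a∈) (in-zs b∈))
    image-non-adjacent : ∀ {y} → y ∈ map f non → ¬ E G x y
    image-non-adjacent y∈ with z , z∈ , refl ← ∈-map⁻ f y∈ = proj₂ (∈-filter⁻ _ {xs = zs} z∈)

  length≤coDegree+coDegree : ∀ {A : Set} {zs : List A} {x x′} (f g : A → Fin n) → Unique zs →
    InjectiveOn zs f → InjectiveOn zs g → (∀ {z} → z ∈ zs → ¬ (E G x (f z) × E G x′ (g z))) →
    length zs ≤ coDegree x + coDegree x′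
  length≤coDegree+coDegree {zs = zs} {x} {x′} f g uzs f-injective g-injective non-common = begin
    length zs                         ≤⟨ length≤filter+filter _ _ zs missing ⟩
    length (filter (λ z → ¬? (E? x (f z))) zs) + length (filter (λ z → ¬? (E? x′ (g z))) zs)
                                      ≤⟨ +-mono-≤ (injective-nonNeighbours≤coDegree f uzs f-injective)
                                                  (injective-nonNeighbours≤coDegree g uzs g-injective) ⟩
    coDegree x + coDegree x′          ∎
    where
    open ≤-Reasoning
    missing : ∀ {z} → z ∈ zs → ¬ E G x (f z) ⊎ ¬ E G x′ (g z)
    missing {z} z∈zs with E? x (f z)
    ... | no ¬e = inj₁ ¬e
    ... | yes e = inj₂ λ e′ → non-common z∈zs (e , e′)

  degree≡2⇒neighbours : ∀ {x y₁ y₂ z} → degree G x ≡ 2 → E G x y₁ → E G x y₂ → y₁ ≢ y₂ →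
                        E G x z → z ≡ y₁ ⊎ z ≡ y₂
  degree≡2⇒neighbours {x} {y₁} {y₂} {z} deg e₁ e₂ y₁≢y₂ e with z ≟ᶠ y₁ | z ≟ᶠ y₂
  ... | yes z≡y₁ | _        = inj₁ z≡y₁
  ... | no  _    | yes z≡y₂ = inj₂ z≡y₂
  ... | no  z≢y₁ | no  z≢y₂ = contradiction (subst (3 ≤_) deg three≤degree) (<⇒≱ (n<1+n 2))
    where
    three≤degree : 3 ≤ degree G x
    three≤degree = subst (3 ≤_) (sym (degree≡length-neighbours x)) (unique-⊆⇒length≤
      ((y₁≢y₂ All.∷ (z≢y₁ ∘ sym) All.∷ All.[]) ∷ ((z≢y₂ ∘ sym) All.∷ All.[]) ∷ All.[] ∷ [])
      λ { (here refl) → ∈-filter⁺ (E? x) (∈-allFin _) e₁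
        ; (there (here refl)) → ∈-filter⁺ (E? x) (∈-allFin _) e₂
        ; (there (there (here refl))) → ∈-filter⁺ (E? x) (∈-allFin _) e })

module Walks {n} (G : Graph n) where

  data Walk : ℕ → Fin n → Fin n → Set where
    stop : ∀ x → Walk 0 x x
    step : ∀ x {ℓ y z} → E G x y → Walk ℓ y z → Walk (suc ℓ) x z

  private variable
    ℓ : ℕ
    x y z : Fin n
    P Q : Fin n → Set

  Every : (Fin n → Set) → Walk ℓ x z → Set
  Every P (stop x)     = P x
  Every P (step x _ w) = P x × Every P w

  Simple : Walk ℓ x z → Set
  Simple (stop _)     = ⊤
  Simple (step x _ w) = Every (_≢ x) w × Simple w

  every-map : (∀ {x} → P x → Q x) → (w : Walk ℓ x z) → Every P w → Every Q w
  every-map f (stop _)     px         = f px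
  every-map f (step _ _ w) (px , pw) = f px , every-map f w pw

  snoc : Walk ℓ x y → E G y z → Walk (suc ℓ) x z
  snoc (stop x)     e = step x e (stop _)
  snoc (step x d w) e = step x d (snoc w e)

  every-snoc : (w : Walk ℓ x y) (e : E G y z) → Every P w → P z → Every P (snoc w e)
  every-snoc (stop _)     e px        pz = px , pz
  every-snoc (step _ _ w) e (px , pw) pz = px , every-snoc w e pw pz

  simple-snoc : (w : Walk ℓ x y) (e : E G y z) → Simple w → Every (_≢ z) w → Simple (snoc w e)
  simple-snoc (stop _)     e _              x≢z         = (x≢z ∘ sym) , tt
  simple-snoc (step _ _ w) e (w≢x , simple) (x≢z , w≢z) =
    every-snoc w e w≢x (x≢z ∘ sym) , simple-snoc w e simple w≢z

  vertex : Walk ℓ x z → Fin (suc ℓ) → Fin n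
  vertex (stop x)     fzero    = x
  vertex (step x _ w) fzero    = x
  vertex (step x _ w) (fsuc i) = vertex w i

  vertex-first : (w : Walk ℓ x z) → vertex w fzero ≡ x
  vertex-first (stop _)     = refl
  vertex-first (step _ _ _) = refl

  vertex-last : (w : Walk ℓ x z) → vertex w (fromℕ ℓ) ≡ z
  vertex-last (stop _)     = refl
  vertex-last (step _ _ w) = vertex-last w

  every-vertex : (w : Walk ℓ x z) → Every P w → ∀ i → P (vertex w i)
  every-vertex (stop _)     px        fzero    = px
  every-vertex (step _ _ w) (px , _)  fzero    = px
  every-vertex (step _ _ w) (_ , pw)  (fsuc i) = every-vertex w pw i

  vertex-injective : (w : Walk ℓ x z) → Simple w → Injective _≡_ _≡_ (vertex w)
  vertex-injective (stop _)     _            {fzero}  {fzero}  _  = refl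
  vertex-injective (step _ _ w) _            {fzero}  {fzero}  _  = refl
  vertex-injective (step _ _ w) (w≢x , _)    {fzero}  {fsuc j} eq = contradiction (sym eq) (every-vertex w w≢x j)
  vertex-injective (step _ _ w) (w≢x , _)    {fsuc i} {fzero}  eq = contradiction eq (every-vertex w w≢x i)
  vertex-injective (step _ _ w) (_ , simple) {fsuc i} {fsuc j} eq = cong fsuc (vertex-injective w simple eq)

  vertex-consecutive : (w : Walk ℓ x z) → Consecutive G (vertex w)
  vertex-consecutive (stop _)     fzero    fzero    ()
  vertex-consecutive (step _ e w) fzero    (fsuc fzero)    _  = subst (E G _) (sym (vertex-first w)) e
  vertex-consecutive (step _ _ w) fzero    (fsuc (fsuc _)) ()
  vertex-consecutive (step _ _ w) (fsuc i) (fsuc j)        eq = vertex-consecutive w i j (suc-injective eq)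

  fromConsecutive : ∀ k (f : Fin (suc k) → Fin n) → Consecutive G f → Walk k (f fzero) (f (fromℕ k))
  fromConsecutive zero    f _    = stop (f fzero)
  fromConsecutive (suc k) f cons = step (f fzero) (cons fzero (fsuc fzero) refl)
    (fromConsecutive k (f ∘ fsuc) (λ i j eq → cons (fsuc i) (fsuc j) (cong suc eq)))

  leaving-edge : {S : Fin n → Set} → Decidable S → Walk ℓ x z → S x → ¬ S z →
                 ∃₂ λ u v → S u × ¬ S v × E G u v
  leaving-edge S? (stop _) sx ¬sz = contradiction sx ¬sz
  leaving-edge S? (step x {y = y} e w) sx ¬sz with S? y
  ... | yes sy = leaving-edge S? w sy ¬sz
  ... | no ¬sy = x , y , sx , ¬sy , e

  close-cycle : ∀ {u v w} → u ≢ w → E G v u → (p : Walk ℓ u w) → Simple p → Every (_≢ v) p →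
                E G w v → Cycle G
  close-cycle u≢w _ (stop _) _ _ _ = contradiction refl u≢w
  close-cycle {v = v} {w} _ vu (step u {ℓ = ℓ} e p) simple p≢v wv =
    ℓ , vertex c , vertex-injective c (p≢v , simple) , vertex-consecutive c ,
    subst (λ x → E G x v) (sym (vertex-last c)) wv
    where
    c : Walk (suc (suc ℓ)) v w
    c = step v vu (step u e p)

-- Adding the vertices of a tree one leaf at a time

module _ {n} (T : Graph n) (t : Fin n) where

  open Walks T
  open import Data.List.Membership.DecPropositional (_≟ᶠ_ {n}) using (_∈?_)

  data Growth : List (Fin n) → Set where
    root   : Growth (t ∷ [])
    attach : ∀ {L u v} → Growth L → u ∈ L → v ∉ L → E T u v →
             (∀ {w} → w ∈ L → E T v w → w ≡ u) → Growth (v ∷ L)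

  private variable
    L : List (Fin n)

  growth-root : Growth L → t ∈ L
  growth-root root                 = here refl
  growth-root (attach g _ _ _ _) = there (growth-root g)

  growth-unique : Growth L → Unique L
  growth-unique root                   = All.[] ∷ []
  growth-unique (attach g _ v∉L _ _) = ∉⇒unique-∷ v∉L (growth-unique g)

  avoiding : ∀ {ℓ a b v} → v ∉ L → (p : Walk ℓ a b) → Every (_∈ L) p → Every (_≢ v) p
  avoiding v∉L = every-map λ z∈L → ∈∧∉⇒≢ z∈L v∉L

  PathWithin : List (Fin n) → Fin n → Fin n → Set
  PathWithin L a b = ∃ λ ℓ → Σ (Walk ℓ a b) λ p → Simple p × Every (_∈ L) p

  growth-paths : Growth L → ∀ {a b} → a ∈ L → b ∈ L → PathWithin L a b
  growth-paths root (here refl) (here refl) = 0 , stop t , tt , here refl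
  growth-paths (attach g u∈L v∉L uv _) (here refl) (here refl) = 0 , stop _ , tt , here refl
  growth-paths (attach g u∈L v∉L uv _) (here refl) (there b∈L)
    with ℓ , p , simple , within ← growth-paths g u∈L b∈L =
    suc ℓ , step _ (E-sym T uv) p , (avoiding v∉L p within , simple) ,
    here refl , every-map there p within
  growth-paths (attach g u∈L v∉L uv _) (there a∈L) (here refl)
    with ℓ , p , simple , within ← growth-paths g a∈L u∈L =
    suc ℓ , snoc p uv , simple-snoc p uv simple (avoiding v∉L p within) ,
    every-snoc p uv (every-map there p within) (here refl)
  growth-paths (attach g _ _ _ _) (there a∈L) (there b∈L)
    with ℓ , p , simple , within ← growth-paths g a∈L b∈L =
    ℓ , p , simple , every-map there p within

  unique-attachment : (Cycle T → ⊥) → Growth L → ∀ {u v w} → v ∉ L → u ∈ L → w ∈ L →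
                      E T v u → E T v w → w ≡ u
  unique-attachment acyclic g {u} {v} {w} v∉L u∈L w∈L vu vw with u ≟ᶠ w
  ... | yes u≡w = sym u≡w
  ... | no  u≢w with _ , p , simple , within ← growth-paths g u∈L w∈L =
    ⊥-elim (acyclic (close-cycle u≢w vu p simple (avoiding v∉L p within) (E-sym T vw)))

  growth-extend : IsTree T → Growth L → ∀ {x} → x ∉ L → ∃ λ v → Growth (v ∷ L)
  growth-extend {L} (connected , acyclic) g {x} x∉L
    with k , f , f₀≡t , fₖ≡x , cons ← connected t x
    with u , v , u∈L , v∉L , uv ← leaving-edge (_∈? L) (fromConsecutive k f cons)
           (subst (_∈ L) (sym f₀≡t) (growth-root g)) (x∉L ∘ subst (_∈ L) fₖ≡x) =
    v , attach g u∈L v∉L uv (λ w∈L vw → unique-attachment acyclic g v∉L u∈L w∈L (E-sym T uv) vw)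

  spanning-growth : IsTree T → ∃ λ L → Growth L × (∀ x → x ∈ L)
  spanning-growth tree = grow n root (m≤m+n n 1)
    where
    grow : ∀ fuel {L} → Growth L → n ≤ fuel + length L → ∃ λ L′ → Growth L′ × (∀ x → x ∈ L′)
    grow fuel {L} g bound with any? (λ x → ¬? (x ∈? L))
    ... | no none = L , g , λ x → decidable-stable (x ∈? L) (λ x∉L → none (x , x∉L))
    grow zero {L} g bound | yes (x , x∉L) = contradiction bound (<⇒≱ (begin-strict
      length L          <⟨ n<1+n _ ⟩
      length (x ∷ L)    ≤⟨ unique-⊆⇒length≤ (∉⇒unique-∷ x∉L (growth-unique g)) (λ _ → ∈-allFin _) ⟩
      length (allFin n) ≡⟨ length-tabulate id ⟩
      n                 ∎))
      where open ≤-Reasoning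
    grow (suc fuel) {L} g bound | yes (x , x∉L) with v , g′ ← growth-extend tree g x∉L =
      grow fuel g′ (subst (n ≤_) (sym (+-suc fuel (length L))) bound)

-- Greedy embedding along a leaf-by-leaf order

EmbeddingOn : ∀ {n N} → Graph n → Graph N → List (Fin n) → (Fin n → Fin N) → Set
EmbeddingOn T H D φ = InjectiveOn D φ × (∀ {u v} → u ∈ D → v ∈ D → E T u v → E H (φ u) (φ v))

module _ {n N} (T : Graph n) (H : Graph N) {S : Fin n → Set} (S? : Decidable S)
         (t : Fin n) (s : Fin N) (high-degree : ∀ y → length (filter S? (allFin n)) ≤ degree H y) where

  greedy-embedding : ∀ {L} → Growth T t L →
                     Σ (Fin n → Fin N) λ φ → φ t ≡ s × EmbeddingOn T H (filter S? L) φ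
  greedy-embedding root = const s , refl , (λ a∈ b∈ _ → trans (is-root a∈) (sym (is-root b∈))) ,
    λ a∈ b∈ ab → contradiction (subst₂ (E T) (is-root a∈) (is-root b∈) ab) (E-irrefl T)
    where
    is-root : ∀ {a} → a ∈ filter S? (t ∷ []) → a ≡ t
    is-root a∈ with here a≡t , _ ← ∈-filter⁻ S? a∈ = a≡t
  greedy-embedding (attach {L} {u} {v} g u∈L v∉L uv parent) with greedy-embedding g | S? v
  ... | φ , φt , embedding          | no  _  = φ , φt , embedding
  ... | φ , φt , injective , edges | yes sv = φ′ , φ′t , injective′ , edges′
    where
    D : List (Fin n)
    D = filter S? L

    in-L : ∀ {a} → a ∈ D → a ∈ L
    in-L = proj₁ ∘ ∈-filter⁻ S? {xs = L}

    D∌v : v ∉ D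
    D∌v = v∉L ∘ in-L

    |D|<|S| : length D < length (filter S? (allFin n))
    |D|<|S| = unique-⊆⇒length≤ (∉⇒unique-∷ D∌v (filter⁺ S? (growth-unique T t g)))
      λ { (here refl) → ∈-filter⁺ S? (∈-allFin v) sv
        ; (there a∈D) → ∈-filter⁺ S? (∈-allFin _) (proj₂ (∈-filter⁻ S? {xs = L} a∈D)) }

    image-smaller : length (map φ D) < length (neighbours H (φ u))
    image-smaller = begin-strict
      length (map φ D)              ≡⟨ length-map φ D ⟩
      length D                      <⟨ |D|<|S| ⟩
      length (filter S? (allFin n)) ≤⟨ high-degree (φ u) ⟩
      degree H (φ u)                ≡⟨ degree≡length-neighbours H (φ u) ⟩
      length (neighbours H (φ u))   ∎
      where open ≤-Reasoning

    free : ∃ λ y → y ∈ neighbours H (φ u) × y ∉ map φ D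
    free = unique-longer⇒∃∉ _≟ᶠ_ (filter⁺ (E? H (φ u)) (allFin⁺ N)) image-smaller

    y : Fin N
    y = proj₁ free

    φu~y : E H (φ u) y
    φu~y = proj₂ (∈-filter⁻ (E? H (φ u)) {xs = allFin N} (proj₁ (proj₂ free)))

    φ′ : Fin n → Fin N
    φ′ = updateAt φ v (const y)

    φ′-on-L : ∀ {a} → a ∈ L → φ′ a ≡ φ a
    φ′-on-L a∈L = updateAt-minimal _ v φ (∈∧∉⇒≢ a∈L v∉L)

    φ′t : φ′ t ≡ s
    φ′t = trans (φ′-on-L (growth-root T t g)) φt

    injective′ : InjectiveOn (v ∷ D) φ′
    injective′ = updateAt-injectiveOn φ v y injective
      λ a∈D φa≡y → proj₂ (proj₂ free) (subst (_∈ map φ D) φa≡y (∈-map⁺ φ a∈D))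

    edge-from-v : ∀ {b} → b ∈ D → E T v b → E H (φ′ v) (φ′ b)
    edge-from-v b∈D vb with refl ← parent (in-L b∈D) vb =
      subst₂ (E H) (sym (updateAt-updates v φ)) (sym (φ′-on-L u∈L)) (E-sym H φu~y)

    edges′ : ∀ {a b} → a ∈ v ∷ D → b ∈ v ∷ D → E T a b → E H (φ′ a) (φ′ b)
    edges′ (here refl) (here refl) vv = contradiction vv (E-irrefl T)
    edges′ (here refl) (there b∈D) vb = edge-from-v b∈D vb
    edges′ (there a∈D) (here refl) av = E-sym H (edge-from-v a∈D (E-sym T av))
    edges′ (there a∈D) (there b∈D) ab =
      subst₂ (E H) (sym (φ′-on-L (in-L a∈D))) (sym (φ′-on-L (in-L b∈D))) (edges a∈D b∈D ab)

module PerfectMatching {k} {B : Set} (_≟_ : DecidableEquality B)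
         {Adj : Fin k → B → Set} (Adj? : ∀ c y → Dec (Adj c y))
         (Y : List B) (Y-unique : Unique Y) (k≤|Y| : k ≤ length Y) (a b : ℕ) (a+b<k : a + b < k)
         (sparse-rows : ∀ c → length (filter (∁? (Adj? c)) Y) ≤ a)
         (sparse-columns : ∀ y → length (filter (λ j → ¬? (Adj? j y)) (allFin k)) ≤ b) where

  open import Data.List.Membership.DecPropositional _≟_ using (_∈?_)

  Allowed : Fin k → B → Set
  Allowed j y = y ∈ Y × Adj j y

  record Matching (D : List (Fin k)) : Set where
    field
      ψ         : Fin k → B
      allowed   : ∀ {j} → j ∈ D → Allowed j (ψ j)
      injective : InjectiveOn D ψ

    unused : List B
    unused = filter (∁? (_∈? map ψ D)) Y

    |Y|≤|D|+|unused| : length Y ≤ length D + length unused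
    |Y|≤|D|+|unused| = begin
      length Y                                        ≡⟨ length-filter-∁ (_∈? map ψ D) Y ⟨
      length (filter (_∈? map ψ D) Y) + length unused ≤⟨ +-monoˡ-≤ _ used≤ ⟩
      length D + length unused                        ∎
      where
      open ≤-Reasoning
      used≤ : length (filter (_∈? map ψ D) Y) ≤ length D
      used≤ = subst (length (filter (_∈? map ψ D) Y) ≤_) (length-map ψ D)
        (unique-⊆⇒length≤ (filter⁺ (_∈? map ψ D) Y-unique)
                           (proj₂ ∘ ∈-filter⁻ (_∈? map ψ D) {xs = Y}))

    unused⊆Y : ∀ {y} → y ∈ unused → y ∈ Y
    unused⊆Y = proj₁ ∘ ∈-filter⁻ (∁? (_∈? map ψ D)) {xs = Y}

    unused-nonempty : length D < k → 0 < length unused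
    unused-nonempty |D|<k = +-cancelˡ-< (length D) 0 _ (begin-strict
      length D + 0             ≡⟨ +-identityʳ _ ⟩
      length D                 <⟨ <-≤-trans |D|<k k≤|Y| ⟩
      length Y                 ≤⟨ |Y|≤|D|+|unused| ⟩
      length D + length unused ∎)
      where open ≤-Reasoning

    unused-fresh : ∀ {y j} → y ∈ unused → j ∈ D → ψ j ≢ y
    unused-fresh y∈unused j∈D ψj≡y =
      proj₂ (∈-filter⁻ (∁? (_∈? map ψ D)) {xs = Y} y∈unused)
            (subst (_∈ map ψ D) ψj≡y (∈-map⁺ ψ j∈D))

  open Matching

  assign : ∀ {D c y} (M : Matching D) → y ∈ unused M → Adj c y → Matching (c ∷ D)
  assign {D} {c} {y} M y∈unused cy = record
    { ψ         = updateAt (ψ M) c (const y)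
    ; allowed   = updateAt-respects (ψ M) c y Allowed (unused⊆Y M y∈unused , cy) (allowed M)
    ; injective = updateAt-injectiveOn (ψ M) c y (injective M) (unused-fresh M y∈unused)
    }

  swap : ∀ {D c j w} (M : Matching D) → w ∈ unused M → j ∈ D → Adj c (ψ M j) → Adj j w →
         Matching (c ∷ D)
  swap {D} {c} {j} {w} M w∈unused j∈D cψj jw = record
    { ψ         = ψ₂
    ; allowed   = allowed₂ ∘ widen
    ; injective = λ a∈ b∈ → injective₂ (widen a∈) (widen b∈)
    }
    where
    ψ₁ ψ₂ : Fin k → B
    ψ₁ = updateAt (ψ M) j (const w)
    ψ₂ = updateAt ψ₁ c (const (ψ M j))

    allowed₁ : ∀ {i} → i ∈ j ∷ D → Allowed i (ψ₁ i)
    allowed₁ = updateAt-respects (ψ M) j w Allowed (unused⊆Y M w∈unused , jw) (allowed M)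

    allowed₂ : ∀ {i} → i ∈ c ∷ j ∷ D → Allowed i (ψ₂ i)
    allowed₂ = updateAt-respects ψ₁ c (ψ M j) Allowed (proj₁ (allowed M j∈D) , cψj) allowed₁

    injective₁ : InjectiveOn (j ∷ D) ψ₁
    injective₁ = updateAt-injectiveOn (ψ M) j w (injective M) (unused-fresh M w∈unused)

    ψ₁≢ψj : ∀ {i} → i ∈ j ∷ D → ψ₁ i ≢ ψ M j
    ψ₁≢ψj {i} i∈ ψ₁i≡ψj with i ≟ᶠ j
    ... | yes refl = unused-fresh M w∈unused j∈D (trans (sym ψ₁i≡ψj) (updateAt-updates j (ψ M)))
    ... | no  i≢j  = i≢j (injective M (∈-∷-≢ i∈ i≢j) j∈D (subst (_≡ ψ M j) (updateAt-minimal i j (ψ M) i≢j) ψ₁i≡ψj))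

    injective₂ : InjectiveOn (c ∷ j ∷ D) ψ₂
    injective₂ = updateAt-injectiveOn ψ₁ c (ψ M j) injective₁ ψ₁≢ψj

    widen : ∀ {i} → i ∈ c ∷ D → i ∈ c ∷ j ∷ D
    widen (here i≡c)  = here i≡c
    widen (there i∈D) = there (there i∈D)

  stuck : ∀ {D c w} → Unique D → (M : Matching D) → w ∈ unused M →
          ¬ Any (Adj c) (unused M) → ¬ Any (λ j → Adj c (ψ M j) × Adj j w) D → ⊥
  stuck {D} {c} {w} D-unique M w∈unused no-assign no-swap = <-irrefl refl (begin-strict
    length Y                               ≤⟨ |Y|≤|D|+|unused| M ⟩
    length D + length U                    ≤⟨ +-monoˡ-≤ (length U) (length≤filter+filter _ _ D bad) ⟩
    (length Bad₁ + length Bad₂) + length U ≡⟨ +-comm (length Bad₁ + length Bad₂) (length U) ⟩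
    length U + (length Bad₁ + length Bad₂) ≡⟨ +-assoc (length U) (length Bad₁) (length Bad₂) ⟨
    (length U + length Bad₁) + length Bad₂ ≤⟨ +-mono-≤ |U|+|Bad₁|≤a |Bad₂|≤b ⟩
    a + b                                  <⟨ a+b<k ⟩
    k                                      ≤⟨ k≤|Y| ⟩
    length Y                               ∎)
    where
    open ≤-Reasoning
    ¬Adj-c? : ∀ j → Dec (¬ Adj c (ψ M j))
    ¬Adj-c? j = ¬? (Adj? c (ψ M j))

    ¬Adj-w? : ∀ j → Dec (¬ Adj j w)
    ¬Adj-w? j = ¬? (Adj? j w)

    U : List B
    Bad₁ Bad₂ : List (Fin k)
    U    = unused M
    Bad₁ = filter ¬Adj-c? D
    Bad₂ = filter ¬Adj-w? D

    bad : ∀ {j} → j ∈ D → ¬ Adj c (ψ M j) ⊎ ¬ Adj j w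
    bad {j} j∈D with Adj? c (ψ M j)
    ... | no ¬cψj = inj₁ ¬cψj
    ... | yes cψj = inj₂ λ jw → no-swap (lose j∈D (cψj , jw))

    in-D : ∀ {j} → j ∈ Bad₁ → j ∈ D
    in-D = proj₁ ∘ ∈-filter⁻ ¬Adj-c? {xs = D}

    disjoint : ∀ {y} → y ∈ U × y ∈ map (ψ M) Bad₁ → ⊥
    disjoint (y∈U , y∈image) with j , j∈Bad₁ , y≡ψj ← ∈-map⁻ (ψ M) y∈image =
      unused-fresh M y∈U (in-D j∈Bad₁) (sym y≡ψj)

    non-adjacent : ∀ {y} → y ∈ U ++ map (ψ M) Bad₁ → y ∈ filter (∁? (Adj? c)) Y
    non-adjacent {y} y∈ with ∈-++⁻ U y∈
    ... | inj₁ y∈U = ∈-filter⁺ (∁? (Adj? c)) (unused⊆Y M y∈U) (no-assign ∘ lose y∈U)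
    ... | inj₂ y∈image with j , j∈Bad₁ , refl ← ∈-map⁻ (ψ M) y∈image =
          ∈-filter⁺ (∁? (Adj? c)) (proj₁ (allowed M (in-D j∈Bad₁)))
                    (proj₂ (∈-filter⁻ ¬Adj-c? {xs = D} j∈Bad₁))

    |U|+|Bad₁|≤a : length U + length Bad₁ ≤ a
    |U|+|Bad₁|≤a = begin
      length U + length Bad₁                 ≡⟨ cong (length U +_) (sym (length-map (ψ M) Bad₁)) ⟩
      length U + length (map (ψ M) Bad₁)     ≡⟨ sym (length-++ U) ⟩
      length (U ++ map (ψ M) Bad₁)           ≤⟨ unique-⊆⇒length≤ U++image-unique non-adjacent ⟩
      length (filter (∁? (Adj? c)) Y)        ≤⟨ sparse-rows c ⟩
      a                                      ∎
      where
      U++image-unique : Unique (U ++ map (ψ M) Bad₁)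
      U++image-unique = ++⁺ (filter⁺ _ Y-unique)
        (map⁺-injectiveOn (filter⁺ _ D-unique) (λ i∈ j∈ → injective M (in-D i∈) (in-D j∈))) disjoint

    |Bad₂|≤b : length Bad₂ ≤ b
    |Bad₂|≤b = ≤-trans (unique-⊆⇒length≤ (filter⁺ _ D-unique)
      λ j∈ → ∈-filter⁺ ¬Adj-w? (∈-allFin _) (proj₂ (∈-filter⁻ ¬Adj-w? {xs = D} j∈)))
      (sparse-columns w)

  extend : ∀ {D c} → Unique D → length D < k → Matching D → Matching (c ∷ D)
  extend {D} {c} D-unique |D|<k M with Any.any? (Adj? c) (unused M)
  ... | yes can-assign with y , y∈unused , cy ← find can-assign = assign M y∈unused cy
  ... | no  no-assign with w , w∈unused ← nonempty⇒∃∈ (unused-nonempty M |D|<k)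
                      with Any.any? (λ j → Adj? c (ψ M j) ×-dec Adj? j w) D
  ...   | yes can-swap with j , j∈D , cψj , jw ← find can-swap = swap M w∈unused j∈D cψj jw
  ...   | no  no-swap  = ⊥-elim (stuck D-unique M w∈unused no-assign no-swap)

  matching : ∀ {D} → Unique D → length D ≤ k → Matching D
  matching {[]} _ _ = record  -- ψ is only constrained on D
    { ψ = λ c → lookup Y (inject≤ c k≤|Y|) ; allowed = λ () ; injective = λ () }
  matching {c ∷ D} (_ ∷ D-unique) |c∷D|≤k =
    extend D-unique |c∷D|≤k (matching D-unique (≤-trans (n≤1+n _) |c∷D|≤k))

  perfect-matching : Σ (Fin k → B) λ ψ → Injective _≡_ _≡_ ψ × (∀ c → ψ c ∈ Y × Adj c (ψ c))
  perfect-matching = ψ M , injective M (∈-allFin _) (∈-allFin _) , λ c → allowed M (∈-allFin c)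
    where
    M : Matching (allFin k)
    M = matching (allFin⁺ k) (≤-reflexive (length-tabulate id))

module BarePaths {n} (T : Graph n) {k} (P : Fin k → Fin 5 → Fin n) (paths : DisjointBarePaths4 T P) where

  i₁ i₂ i₃ : Fin 5
  i₁ = fsuc fzero
  i₂ = fsuc (fsuc fzero)
  i₃ = fsuc (fsuc (fsuc fzero))

  path-injective : ∀ a → Injective _≡_ _≡_ (P a)
  path-injective a = proj₁ (proj₁ paths a)

  paths-disjoint : ∀ a b i j → P a i ≡ P b j → a ≡ b
  paths-disjoint = proj₂ paths

  Mid : Fin n → Set
  Mid v = ∃ λ a → P a i₂ ≡ v

  Mid? : Decidable Mid
  Mid? v = any? λ a → P a i₂ ≟ᶠ v

  off-mid : ∀ a {i} → i ≢ i₂ → ¬ Mid (P a i)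
  off-mid a i≢i₂ (b , Pb≡Pa) with refl ← paths-disjoint b a i₂ _ Pb≡Pa =
    i≢i₂ (sym (path-injective a Pb≡Pa))

  mid-neighbours : ∀ a {z} → E T (P a i₂) z → z ≡ P a i₁ ⊎ z ≡ P a i₃
  mid-neighbours a = degree≡2⇒neighbours T (degree-two i₂ (s≤s z≤n) (s≤s (s≤s z≤n)))
    (E-sym T (consecutive i₁ i₂ refl)) (consecutive i₂ i₃ refl)
    (λ eq → case path-injective a eq of λ ())
    where
    consecutive : Consecutive T (P a)
    consecutive = proj₁ (proj₂ (proj₁ paths a))
    degree-two : ∀ i → 1 ≤ toℕ i → toℕ i ≤ 3 → degree T (P a i) ≡ 2
    degree-two = proj₂ (proj₂ (proj₁ paths a))

  Rest : List (Fin n)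
  Rest = filter (∁? Mid?) (allFin n)

  |Rest|+k≤n : length Rest + k ≤ n
  |Rest|+k≤n = begin
    length Rest + k                               ≡⟨ +-comm (length Rest) k ⟩
    k + length Rest                               ≤⟨ +-monoˡ-≤ (length Rest) k≤|Mid| ⟩
    length (filter Mid? (allFin n)) + length Rest ≡⟨ length-filter-∁ Mid? (allFin n) ⟩
    length (allFin n)                             ≡⟨ length-tabulate id ⟩
    n                                             ∎
    where
    open ≤-Reasoning
    k≤|Mid| : k ≤ length (filter Mid? (allFin n))
    k≤|Mid| = subst (_≤ length (filter Mid? (allFin n))) (trans (length-map _ (allFin k)) (length-tabulate id))
      (unique-⊆⇒length≤ (map⁺ (paths-disjoint _ _ i₂ i₂) (allFin⁺ k))
        λ v∈ → case ∈-map⁻ _ v∈ of λ where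
          (a , _ , refl) → ∈-filter⁺ Mid? (∈-allFin _) (a , refl))

  data Position : Fin n → Set where
    mid : ∀ a → Position (P a i₂)
    off : ∀ {v} → ¬ Mid v → Position v

  position : ∀ v → Position v
  position v with Mid? v
  ... | yes (a , refl) = mid a
  ... | no  ¬mid       = off ¬mid

  module _ {H : Graph n} {φ : Fin n → Fin n} {ψ : Fin k → Fin n}
           (φ-injective : ∀ {u v} → ¬ Mid u → ¬ Mid v → φ u ≡ φ v → u ≡ v)
           (φ-edges : ∀ {u v} → ¬ Mid u → ¬ Mid v → E T u v → E H (φ u) (φ v))
           (ψ-injective : Injective _≡_ _≡_ ψ)
           (ψ-fresh : ∀ a {v} → ¬ Mid v → ψ a ≢ φ v)
           (ψ-adjacent : ∀ a → E H (φ (P a i₁)) (ψ a) × E H (φ (P a i₃)) (ψ a)) where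

    Φ : Fin n → Fin n
    Φ v with Mid? v
    ... | yes (a , _) = ψ a
    ... | no  _       = φ v

    Φ-mid : ∀ a → Φ (P a i₂) ≡ ψ a
    Φ-mid a with Mid? (P a i₂)
    ... | yes (b , Pb≡Pa) = cong ψ (paths-disjoint b a i₂ i₂ Pb≡Pa)
    ... | no  ¬mid        = contradiction (a , refl) ¬mid

    Φ-off-mid : ∀ {v} → ¬ Mid v → Φ v ≡ φ v
    Φ-off-mid {v} ¬mid with Mid? v
    ... | yes m = contradiction m ¬mid
    ... | no  _ = refl

    Φ-injective : Injective _≡_ _≡_ Φ
    Φ-injective {u} {v} Φu≡Φv with position u | position v
    ... | mid a   | mid b   = cong (λ c → P c i₂) (ψ-injective (subst₂ _≡_ (Φ-mid a) (Φ-mid b) Φu≡Φv))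
    ... | mid a   | off ¬mv = contradiction (subst₂ _≡_ (Φ-mid a) (Φ-off-mid ¬mv) Φu≡Φv) (ψ-fresh a ¬mv)
    ... | off ¬mu | mid b   = contradiction (subst₂ _≡_ (Φ-mid b) (Φ-off-mid ¬mu) (sym Φu≡Φv)) (ψ-fresh b ¬mu)
    ... | off ¬mu | off ¬mv = φ-injective ¬mu ¬mv (subst₂ _≡_ (Φ-off-mid ¬mu) (Φ-off-mid ¬mv) Φu≡Φv)

    mid-edge : ∀ a {z} → E T (P a i₂) z → E H (Φ (P a i₂)) (Φ z)
    mid-edge a e with mid-neighbours a e | ψ-adjacent a
    ... | inj₁ refl | end~ψa , _ =
      subst₂ (E H) (sym (Φ-mid a)) (sym (Φ-off-mid (off-mid a λ ()))) (E-sym H end~ψa)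
    ... | inj₂ refl | _ , end~ψa =
      subst₂ (E H) (sym (Φ-mid a)) (sym (Φ-off-mid (off-mid a λ ()))) (E-sym H end~ψa)

    Φ-edges : ∀ {u v} → E T u v → E H (Φ u) (Φ v)
    Φ-edges {u} {v} e with position u | position v
    ... | mid a   | _       = mid-edge a e
    ... | off _   | mid b   = E-sym H (mid-edge b (E-sym T e))
    ... | off ¬mu | off ¬mv =
      subst₂ (E H) (sym (Φ-off-mid ¬mu)) (sym (Φ-off-mid ¬mv)) (φ-edges ¬mu ¬mv e)

    glued-embedding : Σ (Fin n → Fin n) λ Φ → Embedding T H Φ × (∀ {v} → ¬ Mid v → Φ v ≡ φ v)
    glued-embedding = Φ , (Φ-injective , λ _ _ → Φ-edges) , Φ-off-mid

module _ {n} (H T : Graph n) (tree : IsTree T) {k} (P : Fin k → Fin 5 → Fin n)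
         (paths : DisjointBarePaths4 T P) (t s : Fin n) (t-off : ∀ a i → P a i ≢ t)
         (Δ : ℕ) (sparse : ∀ x → coDegree H x ≤ Δ) (4Δ<k : 4 * Δ < k) where

  open BarePaths T P paths
  open import Data.List.Membership.DecPropositional (_≟ᶠ_ {n}) using (_∈?_)

  private
    high-degree : ∀ y → length Rest ≤ degree H y
    high-degree y = +-cancelʳ-≤ (coDegree H y) _ _ (begin
      length Rest + coDegree H y ≤⟨ +-monoʳ-≤ (length Rest) (≤-trans (sparse y) Δ≤k) ⟩
      length Rest + k            ≤⟨ |Rest|+k≤n ⟩
      n                          ≡⟨ degree+coDegree≡n H y ⟨
      degree H y + coDegree H y  ∎)
      where
      open ≤-Reasoning
      Δ≤k : Δ ≤ k
      Δ≤k = ≤-trans (m≤n*m Δ 4) (<⇒≤ 4Δ<k)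

    spanning : ∃ λ L → Growth T t L × (∀ x → x ∈ L)
    spanning = spanning-growth T t tree

    greedy : Σ (Fin n → Fin n) λ φ → φ t ≡ s × EmbeddingOn T H (filter (∁? Mid?) (proj₁ spanning)) φ
    greedy = greedy-embedding T H (∁? Mid?) t s high-degree (proj₁ (proj₂ spanning))

    φ : Fin n → Fin n
    φ = proj₁ greedy

    in-domain : ∀ {v} → ¬ Mid v → v ∈ filter (∁? Mid?) (proj₁ spanning)
    in-domain {v} = ∈-filter⁺ (∁? Mid?) (proj₂ (proj₂ spanning) v)

    φ-injective : ∀ {u v} → ¬ Mid u → ¬ Mid v → φ u ≡ φ v → u ≡ v
    φ-injective ¬mu ¬mv = proj₁ (proj₂ (proj₂ greedy)) (in-domain ¬mu) (in-domain ¬mv)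

    φ-edges : ∀ {u v} → ¬ Mid u → ¬ Mid v → E T u v → E H (φ u) (φ v)
    φ-edges ¬mu ¬mv = proj₂ (proj₂ (proj₂ greedy)) (in-domain ¬mu) (in-domain ¬mv)

    Y : List (Fin n)
    Y = filter (∁? (_∈? map φ Rest)) (allFin n)

    k≤|Y| : k ≤ length Y
    k≤|Y| = +-cancelˡ-≤ (length used) _ _ (begin
      length used + k        ≤⟨ +-monoˡ-≤ k (≤-trans used≤ (≤-reflexive (length-map φ Rest))) ⟩
      length Rest + k        ≤⟨ |Rest|+k≤n ⟩
      n                      ≡⟨ length-tabulate id ⟨
      length (allFin n)      ≡⟨ length-filter-∁ (_∈? map φ Rest) (allFin n) ⟨
      length used + length Y ∎)
      where
      open ≤-Reasoning
      used : List (Fin n)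
      used = filter (_∈? map φ Rest) (allFin n)
      used≤ : length used ≤ length (map φ Rest)
      used≤ = unique-⊆⇒length≤ (filter⁺ _ (allFin⁺ n))
        (proj₂ ∘ ∈-filter⁻ (_∈? map φ Rest) {xs = allFin n})

    Adj : Fin k → Fin n → Set
    Adj a y = E H (φ (P a i₁)) y × E H (φ (P a i₃)) y

    Adj? : ∀ a y → Dec (Adj a y)
    Adj? a y = E? H (φ (P a i₁)) y ×-dec E? H (φ (P a i₃)) y

    end-injective : ∀ {i} → i ≢ i₂ → Injective _≡_ _≡_ (λ a → φ (P a i))
    end-injective i≢i₂ {a} {b} eq =
      paths-disjoint a b _ _ (φ-injective (off-mid a i≢i₂) (off-mid b i≢i₂) eq)

    sparse-rows : ∀ a → length (filter (∁? (Adj? a)) Y) ≤ Δ + Δ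
    sparse-rows a = ≤-trans
      (length≤coDegree+coDegree H id id (filter⁺ _ (filter⁺ _ (allFin⁺ n))) (λ _ _ → id) (λ _ _ → id)
        (proj₂ ∘ ∈-filter⁻ (∁? (Adj? a)) {xs = Y}))
      (+-mono-≤ (sparse _) (sparse _))

    sparse-columns : ∀ y → length (filter (λ a → ¬? (Adj? a y)) (allFin k)) ≤ Δ + Δ
    sparse-columns y = ≤-trans
      (length≤coDegree+coDegree H (λ a → φ (P a i₁)) (λ a → φ (P a i₃)) (filter⁺ _ (allFin⁺ k))
        (λ _ _ → end-injective λ ()) (λ _ _ → end-injective λ ())
        λ a∈ (y~end₁ , y~end₃) →
          proj₂ (∈-filter⁻ (λ a → ¬? (Adj? a y)) {xs = allFin k} a∈)
                (E-sym H y~end₁ , E-sym H y~end₃))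
      (+-mono-≤ (sparse _) (sparse _))

    matching : Σ (Fin k → Fin n) λ ψ → Injective _≡_ _≡_ ψ × (∀ a → ψ a ∈ Y × Adj a (ψ a))
    matching = PerfectMatching.perfect-matching _≟ᶠ_ Adj? Y (filter⁺ _ (allFin⁺ n)) k≤|Y|
      (Δ + Δ) (Δ + Δ) (subst (_< k) 4Δ≡[Δ+Δ]+[Δ+Δ] 4Δ<k) sparse-rows sparse-columns
      where
      4Δ≡[Δ+Δ]+[Δ+Δ] : 4 * Δ ≡ (Δ + Δ) + (Δ + Δ)
      4Δ≡[Δ+Δ]+[Δ+Δ] = trans (cong (λ m → Δ + (Δ + (Δ + m))) (+-identityʳ Δ))
                             (sym (+-assoc Δ Δ (Δ + Δ)))

    ψ : Fin k → Fin n
    ψ = proj₁ matching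

    ψ-fresh : ∀ a {v} → ¬ Mid v → ψ a ≢ φ v
    ψ-fresh a {v} ¬mid ψa≡φv =
      proj₂ (∈-filter⁻ (∁? (_∈? map φ Rest)) {xs = allFin n} (proj₁ (proj₂ (proj₂ matching) a)))
        (subst (_∈ map φ Rest) (sym ψa≡φv) (∈-map⁺ φ (∈-filter⁺ (∁? Mid?) (∈-allFin v) ¬mid)))

  embedding-through-bare-paths : Σ (Fin n → Fin n) λ Φ → Embedding T H Φ × Φ t ≡ s
  embedding-through-bare-paths =
    let Φ , embedding , Φ≡φ = glued-embedding {H} {φ} {ψ} φ-injective φ-edges
                                (proj₁ (proj₂ matching)) ψ-fresh (proj₂ ∘ proj₂ (proj₂ matching))
    in Φ , embedding , trans (Φ≡φ λ (a , Pa≡t) → t-off a i₂ Pa≡t) (proj₁ (proj₂ greedy))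

complement≤fraction : ∀ {p q n d e} → (q ∸ p) * n ≤ q * d → d + e ≡ n → q * e ≤ p * n
complement≤fraction {p} {q} {n} {d} {e} large d+e≡n = +-cancelˡ-≤ (q * d) _ _ (begin
  q * d + q * e       ≡⟨ *-distribˡ-+ q d e ⟨
  q * (d + e)         ≡⟨ cong (q *_) d+e≡n ⟩
  q * n               ≤⟨ *-monoˡ-≤ n (m≤n+m∸n q p) ⟩
  (p + (q ∸ p)) * n   ≡⟨ *-distribʳ-+ n p (q ∸ p) ⟩
  p * n + (q ∸ p) * n ≤⟨ +-monoʳ-≤ (p * n) large ⟩
  p * n + q * d       ≡⟨ +-comm (p * n) (q * d) ⟩
  q * d + p * n       ∎)
  where open ≤-Reasoning

floor-of-fraction : ∀ {p q n k} → 0 < p → 0 < q → 0 < n → 10 * p * n ≤ q * k →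
                    ∃ λ Δ → (∀ {e} → q * e ≤ p * n → e ≤ Δ) × 4 * Δ < k
floor-of-fraction {p} {q} {n} {k} z<s z<s z<s many = p * n / q , below , 4Δ<k
  where
  open ≤-Reasoning

  below : ∀ {e} → q * e ≤ p * n → e ≤ p * n / q
  below {e} qe≤pn = begin
    e         ≡⟨ m*n/n≡m e q ⟨
    e * q / q ≤⟨ /-monoˡ-≤ q (subst (_≤ p * n) (*-comm q e) qe≤pn) ⟩
    p * n / q ∎

  4Δ<k : 4 * (p * n / q) < k
  4Δ<k = *-cancelˡ-< q _ _ (begin-strict
    q * (4 * (p * n / q)) ≡⟨ *-comm q (4 * (p * n / q)) ⟩
    4 * (p * n / q) * q   ≡⟨ *-assoc 4 (p * n / q) q ⟩
    4 * (p * n / q * q)   ≤⟨ *-monoʳ-≤ 4 (m/n*n≤m (p * n) q) ⟩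
    4 * (p * n)           <⟨ *-monoˡ-< (p * n) {4} {10} (m<m+n 4 z<s) ⟩
    10 * (p * n)          ≡⟨ *-assoc 10 p n ⟨
    10 * p * n            ≤⟨ many ⟩
    q * k                 ∎)

-- The argument needs no smallness of μ beyond the hypotheses, hence μ₀ = 1 and n₀ = 0.
lemma6p1 : ∃[ p₀ ] ∃[ q₀ ] (0 < p₀ × 0 < q₀ ×
    (∀ p q → 0 < p → 0 < q → p * q₀ ≤ p₀ * q →
      ∃[ n₀ ] (∀ n → n₀ ≤ n →
        ∀ (H T : Graph n) →
        (∀ v → (q ∸ p) * n ≤ q * degree H v) →
        IsTree T →
        ∀ k (P : Fin k → Fin 5 → Fin n) →
        DisjointBarePaths4 T P →
        10 * p * n ≤ q * k →
        ∀ (t s : Fin n) → (∀ a i → P a i ≢ t) →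
        Σ (Fin n → Fin n) λ φ → Embedding T H φ × φ t ≡ s)))
lemma6p1 = 1 , 1 , z<s , z<s , λ p q p>0 q>0 _ → 0 ,
  λ n _ H T min-degree tree k P paths many t s t-off →
    let Δ , below , 4Δ<k = floor-of-fraction p>0 q>0 (≤-<-trans z≤n (toℕ<n t)) many
    in embedding-through-bare-paths H T tree P paths t s t-off Δ
         (λ x → below (complement≤fraction {p} {q} (min-degree x) (degree+coDegree≡n H x))) 4Δ<k
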